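{- Let $$P(x_1,x_2,x_3,x_4,y_1,y_2,y_3,y_4)=\sum_{i=1}^4 x_i^2y_i^2-4x_1x_2x_3x_4-4y_1y_2y_3y_4-2\sum_{1\le i<j\le 4}x_iy_ix_jy_j .$$ Let $\sigma$ be one of the three fixed-point-free involutions $(12)(34)$, $(14)(23)$, $(13)(24)$ of $\{1,2,3,4\}$, and for numbers $c,s$ define a transformation $(x,y)\mapsto(x',y')$ by $$x_i'=c\,x_i+s\,y_{\sigma(i)},\qquad y'_{\sigma(i)}=-s\,x_i+c\,y_{\sigma(i)}\qquad(i=1,2,3,4).$$ Then $P(x',y')=(c^2+s^2)^2P(x,y)$. Moreover, if $c,s$ are rational with $c^2+s^2=1$ and $x_1,\dots,x_4,y_1,\dots,y_4$ are rational numbers with $P(x,y)=0$ such that each of $$x_1x_2+y_3y_4,\ x_1x_3+y_2y_4,\ x_1x_4+y_2y_3,\ x_2x_3+y_1y_4,\ x_2x_4+y_1y_3,\ x_3x_4+y_1y_2$$ is the square of a rational number, then $x',y'$ are rational, $P(x',y')=0$, and each of the six corresponding quantities $x_1'x_2'+y_3'y_4',\dots,x_3'x_4'+y_1'y_2'$ is again the square of a rational number.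
   Context: A rational solution of the system "all six quantities $x_ix_j+y_ky_l$ (with $\{i,j,k,l\}=\{1,2,3,4\}$) are rational squares" is called regular if it also satisfies $P=0$; this generalises regular Diophantine quadruples (the case $y_i=1$). -}

module Defs where

open import Level using (_⊔_)
open import Algebra.Bundles using (CommutativeRing)
open import Data.Fin using (Fin; zero; suc)
open import Data.Product using (_×_; _,_; ∃)
open import Data.Rational using (ℚ)
open import Data.Rational.Properties using (+-*-commutativeRing)
open import Relation.Binary.PropositionalEquality using (_≡_)

-- Indices 1,2,3,4 of the paper are Fin 4 elements 0,1,2,3.
i₁ i₂ i₃ i₄ : Fin 4
i₁ = zero
i₂ = suc zero
i₃ = suc (suc zero)
i₄ = suc (suc (suc zero))

data Involution : Set where
  σ₁₂₃₄ σ₁₄₂₃ σ₁₃₂₄ : Involution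

act : Involution → Fin 4 → Fin 4
act σ₁₂₃₄ zero = i₂
act σ₁₂₃₄ (suc zero) = i₁
act σ₁₂₃₄ (suc (suc zero)) = i₄
act σ₁₂₃₄ (suc (suc (suc zero))) = i₃
act σ₁₄₂₃ zero = i₄
act σ₁₄₂₃ (suc zero) = i₃
act σ₁₄₂₃ (suc (suc zero)) = i₂
act σ₁₄₂₃ (suc (suc (suc zero))) = i₁
act σ₁₃₂₄ zero = i₃
act σ₁₃₂₄ (suc zero) = i₄
act σ₁₃₂₄ (suc (suc zero)) = i₁
act σ₁₃₂₄ (suc (suc (suc zero))) = i₂

module OverRing {a ℓ} (R : CommutativeRing a ℓ) where
  open CommutativeRing R

  P : (Fin 4 → Carrier) → (Fin 4 → Carrier) → Carrier
  P x y =
    (((x i₁ * x i₁) * (y i₁ * y i₁) + (x i₂ * x i₂) * (y i₂ * y i₂))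
      + ((x i₃ * x i₃) * (y i₃ * y i₃) + (x i₄ * x i₄) * (y i₄ * y i₄)))
    - four * (((x i₁ * x i₂) * x i₃) * x i₄)
    - four * (((y i₁ * y i₂) * y i₃) * y i₄)
    - two * ((((x i₁ * y i₁) * (x i₂ * y i₂) + (x i₁ * y i₁) * (x i₃ * y i₃))
              + ((x i₁ * y i₁) * (x i₄ * y i₄) + (x i₂ * y i₂) * (x i₃ * y i₃)))
             + ((x i₂ * y i₂) * (x i₄ * y i₄) + (x i₃ * y i₃) * (x i₄ * y i₄)))
    where
      two four : Carrier
      two = 1# + 1#
      four = two + two

  x′ : Involution → Carrier → Carrier → (Fin 4 → Carrier) → (Fin 4 → Carrier) → Fin 4 → Carrier
  x′ σ c s x y i = c * x i + s * y (act σ i)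

  -- y'_{σ i} = −s x_i + c y_{σ i}; since σ is an involution, for j = σ i this is
  -- y'_j = −s x_{σ j} + c y_j.
  y′ : Involution → Carrier → Carrier → (Fin 4 → Carrier) → (Fin 4 → Carrier) → Fin 4 → Carrier
  y′ σ c s x y j = (- s) * x (act σ j) + c * y j

module Qdefs = OverRing +-*-commutativeRing
open import Data.Rational using (_+_; _*_)

IsRationalSquare : ℚ → Set
IsRationalSquare q = ∃ λ r → q ≡ r * r

SixSquares : (Fin 4 → ℚ) → (Fin 4 → ℚ) → Set
SixSquares x y =
  IsRationalSquare (x i₁ * x i₂ + y i₃ * y i₄) ×
  IsRationalSquare (x i₁ * x i₃ + y i₂ * y i₄) ×
  IsRationalSquare (x i₁ * x i₄ + y i₂ * y i₃) ×
  IsRationalSquare (x i₂ * x i₃ + y i₁ * y i₄) ×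
  IsRationalSquare (x i₂ * x i₄ + y i₁ * y i₃) ×
  IsRationalSquare (x i₃ * x i₄ + y i₁ * y i₂)

{-# OPTIONS --safe #-}

-- For an involution τ = (i j)(k l) put
--   f_τ (u , v) = A u² + E u v + B v²,
--   A = x_i x_j + y_k y_l,   B = x_k x_l + y_i y_j,
--   E = x_i y_i + x_j y_j - x_k y_k - x_l y_l.
-- The six quantities are the outer coefficients A, B of the three forms f_τ, and
-- every f_τ has discriminant E² - 4 A B = P. The transformation for σ rotates each
-- pair (x_m , y_{σ m}) by (c , s); this turns f_σ into f_σ (c u - s v , s u + c v),
-- a substitution of determinant c² + s², which scales the discriminant P by
-- (c² + s²)². The outer coefficients of the two other forms are inner products of
-- two rotated pairs, so they are just multiplied by c² + s².
-- Over ℚ with c² + s² = 1 and P = 0, f_σ has zero discriminant and square outer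
-- coefficients a², b², hence f_σ = (a u ± b v)², and its new outer coefficients
-- f_σ (c , s) and f_σ (- s , c) are squares again.

module Submission where

open import Defs
open import Level using (Level; 0ℓ; _⊔_)
open import Algebra.Bundles using (CommutativeRing)
open import Algebra.Solver.Ring.AlmostCommutativeRing
  using (fromCommutativeRing; _-Raw-AlmostCommutative⟶_)
open import Data.Fin using (Fin)
open import Data.Integer as ℤ using (ℤ; +_; -[1+_]; _⊖_)
import Data.Integer.Properties as ℤ
open import Data.Maybe as Maybe using (Maybe)
open import Data.Nat as ℕ using (ℕ; zero; suc)
import Data.Nat.Properties as ℕ
open import Data.Product using (_×_; _,_; proj₁; proj₂)
open import Data.Sum using (_⊎_; inj₁; inj₂; [_,_]′)
open import Data.Vec.Functional using ([]; _∷_)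
open import Data.Vec.N-ary using (N-ary)
open import Function using (_∘_)
open import Relation.Binary.Definitions using (DecidableEquality)
open import Relation.Binary.PropositionalEquality as ≡ using (_≡_; _≢_)
open import Relation.Nullary.Decidable using (yes; no; dec⇒maybe)
open import Relation.Nullary.Negation using (contradiction)

module IntegerCoefficients {a ℓ} (R : CommutativeRing a ℓ) where
  open CommutativeRing R
  open import Algebra.Properties.Semiring.Mult.TCOptimised semiring
    using (1+×; ×-homo-+; ×1-homo-*) renaming (_×_ to _·_)
  open import Algebra.Properties.Ring ring using (-‿distribˡ-*; -‿distribʳ-*)
  open import Algebra.Properties.Group +-group using (ε⁻¹≈ε; ⁻¹-involutive)
  open import Algebra.Properties.AbelianGroup +-abelianGroup using (⁻¹-∙-comm)
  open import Algebra.Properties.CommutativeSemigroup +-commutativeSemigroup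
    using (interchange)
  open import Relation.Binary.Reasoning.Setoid setoid

  -- _·_ is the optimised multiple with 1 · x = x definitionally, so con 1ℤ evaluates to
  -- 1# itself and the constants two and four of P match their polynomial versions on the nose.
  ⟦_⟧ : ℤ → Carrier
  ⟦ + n ⟧      = n · 1#
  ⟦ -[1+ n ] ⟧ = - (suc n · 1#)

  private
    [1+x]-[1+y]≈x-y : ∀ x y → (1# + x) - (1# + y) ≈ x - y
    [1+x]-[1+y]≈x-y x y = begin
      (1# + x) + - (1# + y)     ≈⟨ +-congˡ (⁻¹-∙-comm 1# y) ⟨
      (1# + x) + (- 1# + - y)   ≈⟨ interchange 1# x (- 1#) (- y) ⟩
      (1# + - 1#) + (x + - y)   ≈⟨ +-congʳ (-‿inverseʳ 1#) ⟩
      0# + (x - y)              ≈⟨ +-identityˡ (x - y) ⟩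
      x - y                     ∎

    -x*-y≈x*y : ∀ x y → - x * - y ≈ x * y
    -x*-y≈x*y x y = begin
      - x * - y       ≈⟨ -‿distribˡ-* x (- y) ⟨
      - (x * - y)     ≈⟨ -‿cong (-‿distribʳ-* x y) ⟨
      - - (x * y)     ≈⟨ ⁻¹-involutive (x * y) ⟩
      x * y           ∎

  ⟦⊖⟧ : ∀ m n → ⟦ m ⊖ n ⟧ ≈ m · 1# - n · 1#
  ⟦⊖⟧ m       zero    = sym (trans (+-congˡ ε⁻¹≈ε) (+-identityʳ (m · 1#)))
  ⟦⊖⟧ zero    (suc n) = sym (+-identityˡ _)
  ⟦⊖⟧ (suc m) (suc n) = begin
    ⟦ suc m ⊖ suc n ⟧                 ≡⟨ ≡.cong ⟦_⟧ (ℤ.[1+m]⊖[1+n]≡m⊖n m n) ⟩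
    ⟦ m ⊖ n ⟧                         ≈⟨ ⟦⊖⟧ m n ⟩
    m · 1# - n · 1#                   ≈⟨ [1+x]-[1+y]≈x-y (m · 1#) (n · 1#) ⟨
    (1# + m · 1#) - (1# + n · 1#)     ≈⟨ +-cong (1+× m 1#) (-‿cong (1+× n 1#)) ⟨
    suc m · 1# - suc n · 1#           ∎

  ⟦⟧-homo-+ : ∀ i j → ⟦ i ℤ.+ j ⟧ ≈ ⟦ i ⟧ + ⟦ j ⟧
  ⟦⟧-homo-+ (+ m)      (+ n)      = ×-homo-+ 1# m n
  ⟦⟧-homo-+ (+ m)      -[1+ n ]   = ⟦⊖⟧ m (suc n)
  ⟦⟧-homo-+ -[1+ m ]   (+ n)      = trans (⟦⊖⟧ n (suc m)) (+-comm _ _)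
  ⟦⟧-homo-+ -[1+ m ]   -[1+ n ]   = begin
    - (suc (suc (m ℕ.+ n)) · 1#)      ≡⟨ ≡.cong (λ k → - (suc k · 1#)) (ℕ.+-suc m n) ⟨
    - ((suc m ℕ.+ suc n) · 1#)        ≈⟨ -‿cong (×-homo-+ 1# (suc m) (suc n)) ⟩
    - (suc m · 1# + suc n · 1#)       ≈⟨ ⁻¹-∙-comm (suc m · 1#) (suc n · 1#) ⟨
    - (suc m · 1#) + - (suc n · 1#)   ∎

  ⟦⟧-homo-neg : ∀ i → ⟦ ℤ.- i ⟧ ≈ - ⟦ i ⟧
  ⟦⟧-homo-neg (+ zero)  = sym ε⁻¹≈ε
  ⟦⟧-homo-neg (+ suc n) = refl
  ⟦⟧-homo-neg -[1+ n ]  = sym (⁻¹-involutive _)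

  private
    ⟦⟧-homo-*-pos : ∀ m n → ⟦ + m ℤ.* + n ⟧ ≈ ⟦ + m ⟧ * ⟦ + n ⟧
    ⟦⟧-homo-*-pos m n = trans (reflexive (≡.cong ⟦_⟧ (≡.sym (ℤ.pos-* m n)))) (×1-homo-* m n)

  ⟦⟧-homo-* : ∀ i j → ⟦ i ℤ.* j ⟧ ≈ ⟦ i ⟧ * ⟦ j ⟧
  ⟦⟧-homo-* (+ m)    (+ n)    = ⟦⟧-homo-*-pos m n
  ⟦⟧-homo-* (+ m)    -[1+ n ] = begin
    ⟦ + m ℤ.* -[1+ n ] ⟧              ≡⟨ ≡.cong ⟦_⟧ (ℤ.neg-distribʳ-* (+ m) (+ suc n)) ⟨
    ⟦ ℤ.- (+ m ℤ.* + suc n) ⟧         ≈⟨ ⟦⟧-homo-neg (+ m ℤ.* + suc n) ⟩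
    - ⟦ + m ℤ.* + suc n ⟧             ≈⟨ -‿cong (⟦⟧-homo-*-pos m (suc n)) ⟩
    - (m · 1# * suc n · 1#)           ≈⟨ -‿distribʳ-* (m · 1#) (suc n · 1#) ⟩
    m · 1# * - (suc n · 1#)           ∎
  ⟦⟧-homo-* -[1+ m ] (+ n)    = begin
    ⟦ -[1+ m ] ℤ.* + n ⟧              ≡⟨ ≡.cong ⟦_⟧ (ℤ.neg-distribˡ-* (+ suc m) (+ n)) ⟨
    ⟦ ℤ.- (+ suc m ℤ.* + n) ⟧         ≈⟨ ⟦⟧-homo-neg (+ suc m ℤ.* + n) ⟩
    - ⟦ + suc m ℤ.* + n ⟧             ≈⟨ -‿cong (⟦⟧-homo-*-pos (suc m) n) ⟩
    - (suc m · 1# * n · 1#)           ≈⟨ -‿distribˡ-* (suc m · 1#) (n · 1#) ⟩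
    - (suc m · 1#) * n · 1#           ∎
  ⟦⟧-homo-* -[1+ m ] -[1+ n ] =
    trans (⟦⟧-homo-*-pos (suc m) (suc n)) (sym (-x*-y≈x*y (suc m · 1#) (suc n · 1#)))

  homomorphism : ℤ.+-*-rawRing -Raw-AlmostCommutative⟶ fromCommutativeRing R
  homomorphism = record
    { ⟦_⟧    = ⟦_⟧
    ; +-homo = ⟦⟧-homo-+
    ; *-homo = ⟦⟧-homo-*
    ; -‿homo = ⟦⟧-homo-neg
    ; 0-homo = refl
    ; 1-homo = refl
    }

  ⟦⟧-≟ : ∀ i j → Maybe (⟦ i ⟧ ≈ ⟦ j ⟧)
  ⟦⟧-≟ i j = Maybe.map (λ i≡j → reflexive (≡.cong ⟦_⟧ i≡j)) (dec⇒maybe (i ℤ.≟ j))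

-- Coefficients taken from R itself could not be compared for zero, so the solver works
-- with ℤ coefficients; polynomials up to equality of all evaluations form a commutative
-- ring, which lets the definitions of Defs and below be instantiated at polynomials.
module IntegerCoefficientSolver {a ℓ} (R : CommutativeRing a ℓ) where
  open CommutativeRing R
  open IntegerCoefficients R using (homomorphism; ⟦⟧-≟)
  open import Algebra.Solver.Ring ℤ.+-*-rawRing (fromCommutativeRing R) homomorphism ⟦⟧-≟ public
    using (Polynomial; con; _:+_; _:*_; _:-_; :-_; _:=_; solve; ⟦_⟧)

  polynomialRing : ℕ → CommutativeRing 0ℓ (a ⊔ ℓ)
  polynomialRing n = record
    { Carrier = Polynomial n
    ; _≈_     = λ p q → ∀ ρ → ⟦ p ⟧ ρ ≈ ⟦ q ⟧ ρ
    ; _+_     = _:+_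
    ; _*_     = _:*_
    ; -_      = :-_
    ; 0#      = con ℤ.0ℤ
    ; 1#      = con ℤ.1ℤ
    ; isCommutativeRing = record
      { isRing = record
        { +-isAbelianGroup = record
          { isGroup = record
            { isMonoid = record
              { isSemigroup = record
                { isMagma = record
                  { isEquivalence = record
                    { refl  = λ ρ → refl
                    ; sym   = λ p≈q ρ → sym (p≈q ρ)
                    ; trans = λ p≈q q≈r ρ → trans (p≈q ρ) (q≈r ρ)
                    }
                  ; ∙-cong = λ p≈q r≈s ρ → +-cong (p≈q ρ) (r≈s ρ)
                  }
                ; assoc = λ p q r ρ → +-assoc (⟦ p ⟧ ρ) (⟦ q ⟧ ρ) (⟦ r ⟧ ρ)
                }
              ; identity = (λ p ρ → +-identityˡ (⟦ p ⟧ ρ)) , (λ p ρ → +-identityʳ (⟦ p ⟧ ρ))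
              }
            ; inverse = (λ p ρ → -‿inverseˡ (⟦ p ⟧ ρ)) , (λ p ρ → -‿inverseʳ (⟦ p ⟧ ρ))
            ; ⁻¹-cong = λ p≈q ρ → -‿cong (p≈q ρ)
            }
          ; comm = λ p q ρ → +-comm (⟦ p ⟧ ρ) (⟦ q ⟧ ρ)
          }
        ; *-cong     = λ p≈q r≈s ρ → *-cong (p≈q ρ) (r≈s ρ)
        ; *-assoc    = λ p q r ρ → *-assoc (⟦ p ⟧ ρ) (⟦ q ⟧ ρ) (⟦ r ⟧ ρ)
        ; *-identity = (λ p ρ → *-identityˡ (⟦ p ⟧ ρ)) , (λ p ρ → *-identityʳ (⟦ p ⟧ ρ))
        ; distrib    = (λ p q r ρ → distribˡ (⟦ p ⟧ ρ) (⟦ q ⟧ ρ) (⟦ r ⟧ ρ))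
                     , (λ p q r ρ → distribʳ (⟦ p ⟧ ρ) (⟦ q ⟧ ρ) (⟦ r ⟧ ρ))
        }
      ; *-comm = λ p q ρ → *-comm (⟦ p ⟧ ρ) (⟦ q ⟧ ρ)
      }
    }

module BinaryForms {a ℓ} (R : CommutativeRing a ℓ) where
  open CommutativeRing R

  record BinaryQuadraticForm : Set a where
    constructor ⟨_,_,_⟩
    field
      α β γ : Carrier

  open BinaryQuadraticForm public

  _≋_ : BinaryQuadraticForm → BinaryQuadraticForm → Set ℓ
  f ≋ g = α f ≈ α g × β f ≈ β g × γ f ≈ γ g

  two four : Carrier
  two  = 1# + 1#
  four = two + two

  value : BinaryQuadraticForm → Carrier → Carrier → Carrier
  value f u v = α f * u * u + β f * u * v + γ f * v * v

  discriminant : BinaryQuadraticForm → Carrier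
  discriminant f = β f * β f - four * (α f * γ f)

  -- the form (u , v) ↦ f (p u + q v , r u + t v)
  substitute : Carrier → Carrier → Carrier → Carrier → BinaryQuadraticForm → BinaryQuadraticForm
  substitute p q r t f =
    ⟨ value f p r , two * α f * p * q + β f * (p * t + q * r) + two * γ f * r * t , value f q t ⟩

  rotateˣ rotateʸ : Carrier → Carrier → Carrier → Carrier → Carrier
  rotateˣ c s u v = c * u + s * v
  rotateʸ c s u v = (- s) * u + c * v

  -- relabel σ lists the indices as i, σ i, k, σ k; it conjugates σ to (12)(34).
  relabel : Involution → Fin 4 → Fin 4
  relabel σ₁₂₃₄ = i₁ ∷ i₂ ∷ i₃ ∷ i₄ ∷ []
  relabel σ₁₄₂₃ = i₁ ∷ i₄ ∷ i₂ ∷ i₃ ∷ []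
  relabel σ₁₃₂₄ = i₁ ∷ i₃ ∷ i₂ ∷ i₄ ∷ []

  form : Involution → (Fin 4 → Carrier) → (Fin 4 → Carrier) → BinaryQuadraticForm
  form σ x y =
    ⟨ x̃ i₁ * x̃ i₂ + ỹ i₃ * ỹ i₄
    , (x̃ i₁ * ỹ i₁ + x̃ i₂ * ỹ i₂) - (x̃ i₃ * ỹ i₃ + x̃ i₄ * ỹ i₄)
    , x̃ i₃ * x̃ i₄ + ỹ i₁ * ỹ i₂ ⟩
    where
    x̃ ỹ : Fin 4 → Carrier
    x̃ = x ∘ relabel σ
    ỹ = y ∘ relabel σ

module Invariance {a ℓ} (R : CommutativeRing a ℓ) where
  open CommutativeRing R
  open OverRing R
  open BinaryForms R
  open IntegerCoefficientSolver R
    using (Polynomial; polynomialRing; solve; _:=_; _:+_; _:*_; _:-_; :-_)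
  open import Relation.Binary.Reasoning.Setoid setoid

  private
    module Formal {n : ℕ} where
      open BinaryForms (polynomialRing n) public
      open OverRing (polynomialRing n) public

  value-cong : ∀ {f g} → f ≋ g → ∀ u v → value f u v ≈ value g u v
  value-cong (α≈ , β≈ , γ≈) u v =
    +-cong (+-cong (*-congʳ (*-congʳ α≈)) (*-congʳ (*-congʳ β≈))) (*-congʳ (*-congʳ γ≈))

  discriminant-cong : ∀ {f g} → f ≋ g → discriminant f ≈ discriminant g
  discriminant-cong (α≈ , β≈ , γ≈) = +-cong (*-cong β≈ β≈) (-‿cong (*-congˡ (*-cong α≈ γ≈)))

  discriminant-substitute : ∀ p q r t f →
    discriminant (substitute p q r t f) ≈ (p * t - q * r) * (p * t - q * r) * discriminant f
  discriminant-substitute p q r t f =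
    solve 7 (λ p q r t A B C →
      Formal.discriminant (Formal.substitute p q r t Formal.⟨ A , B , C ⟩)
        := (p :* t :- q :* r) :* (p :* t :- q :* r) :* Formal.discriminant Formal.⟨ A , B , C ⟩)
      refl p q r t (α f) (β f) (γ f)

  4a²b²≈[2ab]² : ∀ a b → four * (a * a * (b * b)) ≈ two * a * b * (two * a * b)
  4a²b²≈[2ab]² = solve 2 (λ a b →
    Formal.four :* (a :* a :* (b :* b)) := Formal.two :* a :* b :* (Formal.two :* a :* b)) refl

  value-perfect-square : ∀ a b u v →
    value ⟨ a * a , two * a * b , b * b ⟩ u v ≈ (a * u + b * v) * (a * u + b * v)
  value-perfect-square = solve 4 (λ a b u v →
    Formal.value Formal.⟨ a :* a , Formal.two :* a :* b , b :* b ⟩ u v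
      := (a :* u :+ b :* v) :* (a :* u :+ b :* v)) refl

  value-perfect-square′ : ∀ a b u v →
    value ⟨ a * a , - (two * a * b) , b * b ⟩ u v ≈ (a * u - b * v) * (a * u - b * v)
  value-perfect-square′ = solve 4 (λ a b u v →
    Formal.value Formal.⟨ a :* a , :- (Formal.two :* a :* b) , b :* b ⟩ u v
      := (a :* u :- b :* v) :* (a :* u :- b :* v)) refl

  rotation-determinant : ∀ c s → c * c - (- s) * s ≈ c * c + s * s
  rotation-determinant = solve 2 (λ c s → c :* c :- (:- s) :* s := c :* c :+ s :* s) refl

  rotation-scales-dot : ∀ c s {u v u′ v′} →
    rotateˣ c s u v * rotateˣ c s u′ v′ + rotateʸ c s u v * rotateʸ c s u′ v′
      ≈ (c * c + s * s) * (u * u′ + v * v′)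
  rotation-scales-dot c s {u} {v} {u′} {v′} =
    solve 6 (λ c s u v u′ v′ →
      Formal.rotateˣ c s u v :* Formal.rotateˣ c s u′ v′
        :+ Formal.rotateʸ c s u v :* Formal.rotateʸ c s u′ v′
        := (c :* c :+ s :* s) :* (u :* u′ :+ v :* v′))
      refl c s u v u′ v′

  rotation-scales-dot′ : ∀ c s {u v u′ v′} →
    rotateˣ c s u v * rotateˣ c s u′ v′ + rotateʸ c s u′ v′ * rotateʸ c s u v
      ≈ (c * c + s * s) * (u * u′ + v′ * v)
  rotation-scales-dot′ c s {u} {v} {u′} {v′} =
    solve 6 (λ c s u v u′ v′ →
      Formal.rotateˣ c s u v :* Formal.rotateˣ c s u′ v′
        :+ Formal.rotateʸ c s u′ v′ :* Formal.rotateʸ c s u v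
        := (c :* c :+ s :* s) :* (u :* u′ :+ v′ :* v))
      refl c s u v u′ v′

  private
    form-rotate-formal :
      (Formal.BinaryQuadraticForm → Polynomial 10) →
      N-ary 10 (Polynomial 10) (Polynomial 10 × Polynomial 10)
    form-rotate-formal coefficient c s x₁ x₂ x₃ x₄ y₁ y₂ y₃ y₄ =
      coefficient (Formal.form σ₁₂₃₄ (Formal.x′ σ₁₂₃₄ c s x y) (Formal.y′ σ₁₂₃₄ c s x y))
        := coefficient (Formal.substitute c (:- s) s c (Formal.form σ₁₂₃₄ x y))
      where
      x y : Fin 4 → Polynomial 10
      x = x₁ ∷ x₂ ∷ x₃ ∷ x₄ ∷ []
      y = y₁ ∷ y₂ ∷ y₃ ∷ y₄ ∷ []

    P≈discriminant-formal : Involution → N-ary 8 (Polynomial 8) (Polynomial 8 × Polynomial 8)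
    P≈discriminant-formal σ x₁ x₂ x₃ x₄ y₁ y₂ y₃ y₄ =
      Formal.P x y := Formal.discriminant (Formal.form σ x y)
      where
      x y : Fin 4 → Polynomial 8
      x = x₁ ∷ x₂ ∷ x₃ ∷ x₄ ∷ []
      y = y₁ ∷ y₂ ∷ y₃ ∷ y₄ ∷ []

  form-rotate : ∀ σ c s x y →
    form σ (x′ σ c s x y) (y′ σ c s x y) ≋ substitute c (- s) s c (form σ x y)
  form-rotate σ₁₂₃₄ c s x y =
      solve 10 (form-rotate-formal Formal.α) refl c s (x i₁) (x i₂) (x i₃) (x i₄) (y i₁) (y i₂) (y i₃) (y i₄)
    , solve 10 (form-rotate-formal Formal.β) refl c s (x i₁) (x i₂) (x i₃) (x i₄) (y i₁) (y i₂) (y i₃) (y i₄)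
    , solve 10 (form-rotate-formal Formal.γ) refl c s (x i₁) (x i₂) (x i₃) (x i₄) (y i₁) (y i₂) (y i₃) (y i₄)
  form-rotate σ₁₄₂₃ c s x y = form-rotate σ₁₂₃₄ c s (x ∘ relabel σ₁₄₂₃) (y ∘ relabel σ₁₄₂₃)
  form-rotate σ₁₃₂₄ c s x y = form-rotate σ₁₂₃₄ c s (x ∘ relabel σ₁₃₂₄) (y ∘ relabel σ₁₃₂₄)

  P≈discriminant : ∀ σ x y → P x y ≈ discriminant (form σ x y)
  P≈discriminant σ₁₂₃₄ x y =
    solve 8 (P≈discriminant-formal σ₁₂₃₄) refl (x i₁) (x i₂) (x i₃) (x i₄) (y i₁) (y i₂) (y i₃) (y i₄)
  P≈discriminant σ₁₄₂₃ x y =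
    solve 8 (P≈discriminant-formal σ₁₄₂₃) refl (x i₁) (x i₂) (x i₃) (x i₄) (y i₁) (y i₂) (y i₃) (y i₄)
  P≈discriminant σ₁₃₂₄ x y =
    solve 8 (P≈discriminant-formal σ₁₃₂₄) refl (x i₁) (x i₂) (x i₃) (x i₄) (y i₁) (y i₂) (y i₃) (y i₄)

  P-rotate : ∀ σ c s x y →
    P (x′ σ c s x y) (y′ σ c s x y) ≈ (c * c + s * s) * (c * c + s * s) * P x y
  P-rotate σ c s x y = begin
    P (x′ σ c s x y) (y′ σ c s x y)
      ≈⟨ P≈discriminant σ (x′ σ c s x y) (y′ σ c s x y) ⟩
    discriminant (form σ (x′ σ c s x y) (y′ σ c s x y))
      ≈⟨ discriminant-cong (form-rotate σ c s x y) ⟩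
    discriminant (substitute c (- s) s c (form σ x y))
      ≈⟨ discriminant-substitute c (- s) s c (form σ x y) ⟩
    (c * c - (- s) * s) * (c * c - (- s) * s) * discriminant (form σ x y)
      ≈⟨ *-cong (*-cong (rotation-determinant c s) (rotation-determinant c s))
                (sym (P≈discriminant σ x y)) ⟩
    (c * c + s * s) * (c * c + s * s) * P x y ∎

  outer-scaled : ∀ {σ τ} → τ ≢ σ → ∀ c s x y →
    α (form τ (x′ σ c s x y) (y′ σ c s x y)) ≈ (c * c + s * s) * α (form τ x y) ×
    γ (form τ (x′ σ c s x y) (y′ σ c s x y)) ≈ (c * c + s * s) * γ (form τ x y)
  outer-scaled {σ₁₂₃₄} {σ₁₂₃₄} τ≢σ = contradiction ≡.refl τ≢σ
  outer-scaled {σ₁₄₂₃} {σ₁₄₂₃} τ≢σ = contradiction ≡.refl τ≢σ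
  outer-scaled {σ₁₃₂₄} {σ₁₃₂₄} τ≢σ = contradiction ≡.refl τ≢σ
  outer-scaled {σ₁₂₃₄} {σ₁₄₂₃} _ c s x y = rotation-scales-dot c s , rotation-scales-dot c s
  outer-scaled {σ₁₂₃₄} {σ₁₃₂₄} _ c s x y = rotation-scales-dot c s , rotation-scales-dot c s
  outer-scaled {σ₁₃₂₄} {σ₁₂₃₄} _ c s x y = rotation-scales-dot c s , rotation-scales-dot c s
  outer-scaled {σ₁₄₂₃} {σ₁₂₃₄} _ c s x y = rotation-scales-dot′ c s , rotation-scales-dot′ c s
  outer-scaled {σ₁₄₂₃} {σ₁₃₂₄} _ c s x y = rotation-scales-dot′ c s , rotation-scales-dot′ c s
  outer-scaled {σ₁₃₂₄} {σ₁₄₂₃} _ c s x y = rotation-scales-dot′ c s , rotation-scales-dot′ c s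

_≟_ : DecidableEquality Involution
σ₁₂₃₄ ≟ σ₁₂₃₄ = yes ≡.refl
σ₁₂₃₄ ≟ σ₁₄₂₃ = no λ ()
σ₁₂₃₄ ≟ σ₁₃₂₄ = no λ ()
σ₁₄₂₃ ≟ σ₁₂₃₄ = no λ ()
σ₁₄₂₃ ≟ σ₁₄₂₃ = yes ≡.refl
σ₁₄₂₃ ≟ σ₁₃₂₄ = no λ ()
σ₁₃₂₄ ≟ σ₁₂₃₄ = no λ ()
σ₁₃₂₄ ≟ σ₁₄₂₃ = no λ ()
σ₁₃₂₄ ≟ σ₁₃₂₄ = yes ≡.refl

open import Data.Rational using (ℚ; _+_; _*_; _-_; -_; 0ℚ; 1ℚ; 1/_; NonZero; ≢-nonZero)
import Data.Rational.Properties as ℚ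

module Rational where
  open BinaryForms ℚ.+-*-commutativeRing
  open Invariance ℚ.+-*-commutativeRing
  open OverRing ℚ.+-*-commutativeRing using (P; x′; y′)
  open import Algebra.Properties.Group ℚ.+-0-group using (x∙y⁻¹≈ε⇒x≈y; inverseˡ-unique)
  open import Data.Rational.Solver using (module +-*-Solver)
  open ≡.≡-Reasoning

  p*q≡0⇒p≡0∨q≡0 : ∀ p q → p * q ≡ 0ℚ → p ≡ 0ℚ ⊎ q ≡ 0ℚ
  p*q≡0⇒p≡0∨q≡0 p q pq≡0 with p ℚ.≟ 0ℚ
  ... | yes p≡0 = inj₁ p≡0
  ... | no  p≢0 = inj₂ (begin
    q                ≡⟨ ℚ.*-identityˡ q ⟨
    1ℚ * q           ≡⟨ ≡.cong (_* q) (ℚ.*-inverseˡ p) ⟨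
    1/ p * p * q     ≡⟨ ℚ.*-assoc (1/ p) p q ⟩
    1/ p * (p * q)   ≡⟨ ≡.cong (1/ p *_) pq≡0 ⟩
    1/ p * 0ℚ        ≡⟨ ℚ.*-zeroʳ (1/ p) ⟩
    0ℚ               ∎)
    where
    instance
      p-nonZero : NonZero p
      p-nonZero = ≢-nonZero p≢0

  p*p≡q*q⇒p≡q∨p≡-q : ∀ p q → p * p ≡ q * q → p ≡ q ⊎ p ≡ - q
  p*p≡q*q⇒p≡q∨p≡-q p q p²≡q² =
    [ (λ p-q≡0 → inj₁ (x∙y⁻¹≈ε⇒x≈y p q p-q≡0)) , (λ p+q≡0 → inj₂ (inverseˡ-unique p q p+q≡0)) ]′
      (p*q≡0⇒p≡0∨q≡0 (p - q) (p + q) (begin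
        (p - q) * (p + q)  ≡⟨ difference-of-squares p q ⟩
        p * p - q * q      ≡⟨ ≡.cong (_- q * q) p²≡q² ⟩
        q * q - q * q      ≡⟨ ℚ.+-inverseʳ (q * q) ⟩
        0ℚ                 ∎))
    where
    open +-*-Solver
    difference-of-squares : ∀ p q → (p - q) * (p + q) ≡ p * p - q * q
    difference-of-squares = solve 2 (λ p q → (p :- q) :* (p :+ q) := p :* p :- q :* q) ≡.refl

  OuterSquares : BinaryQuadraticForm → Set
  OuterSquares f = IsRationalSquare (α f) × IsRationalSquare (γ f)

  value-isSquare : ∀ f → discriminant f ≡ 0ℚ → OuterSquares f → ∀ u v → IsRationalSquare (value f u v)
  value-isSquare f Δ≡0 ((a , α≡aa) , (b , γ≡bb)) u v =
    [ (λ β≡2ab → a * u + b * v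
               , ≡.trans (value-cong (α≡aa , β≡2ab , γ≡bb) u v) (value-perfect-square a b u v))
    , (λ β≡-2ab → a * u - b * v
               , ≡.trans (value-cong (α≡aa , β≡-2ab , γ≡bb) u v) (value-perfect-square′ a b u v))
    ]′ (p*p≡q*q⇒p≡q∨p≡-q (β f) (two * a * b) β²≡[2ab]²)
    where
    β²≡[2ab]² : β f * β f ≡ two * a * b * (two * a * b)
    β²≡[2ab]² = begin
      β f * β f                    ≡⟨ x∙y⁻¹≈ε⇒x≈y _ _ Δ≡0 ⟩
      four * (α f * γ f)           ≡⟨ ≡.cong (four *_) (≡.cong₂ _*_ α≡aa γ≡bb) ⟩
      four * (a * a * (b * b))     ≡⟨ 4a²b²≈[2ab]² a b ⟩
      two * a * b * (two * a * b)  ∎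

  substitute-outerSquares : ∀ f → discriminant f ≡ 0ℚ → OuterSquares f →
    ∀ p q r t → OuterSquares (substitute p q r t f)
  substitute-outerSquares f Δ≡0 squares p q r t =
    value-isSquare f Δ≡0 squares p r , value-isSquare f Δ≡0 squares q t

  outerSquares-resp-≋ : ∀ {f g} → f ≋ g → OuterSquares g → OuterSquares f
  outerSquares-resp-≋ (α≡ , _ , γ≡) ((a , α≡aa) , (b , γ≡bb)) =
    (a , ≡.trans α≡ α≡aa) , (b , ≡.trans γ≡ γ≡bb)

  unit-multiple-isSquare : ∀ {k p q} → k ≡ 1ℚ → p ≡ k * q → IsRationalSquare q → IsRationalSquare p
  unit-multiple-isSquare ≡.refl p≡1q (r , q≡rr) = r , ≡.trans p≡1q (≡.trans (ℚ.*-identityˡ _) q≡rr)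

  transformed-outerSquares : ∀ σ τ c s → c * c + s * s ≡ 1ℚ → ∀ x y → P x y ≡ 0ℚ →
    OuterSquares (form τ x y) → OuterSquares (form τ (x′ σ c s x y) (y′ σ c s x y))
  transformed-outerSquares σ τ c s c²+s²≡1 x y P≡0 squares with τ ≟ σ
  ... | yes ≡.refl = outerSquares-resp-≋ (form-rotate σ c s x y)
    (substitute-outerSquares (form σ x y) (≡.trans (≡.sym (P≈discriminant σ x y)) P≡0) squares c (- s) s c)
  ... | no τ≢σ =
      unit-multiple-isSquare c²+s²≡1 (proj₁ (outer-scaled τ≢σ c s x y)) (proj₁ squares)
    , unit-multiple-isSquare c²+s²≡1 (proj₂ (outer-scaled τ≢σ c s x y)) (proj₂ squares)

  sixSquares⇒outerSquares : ∀ x y → SixSquares x y → ∀ τ → OuterSquares (form τ x y)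
  sixSquares⇒outerSquares x y (□₁₂ , □₁₃ , □₁₄ , □₂₃ , □₂₄ , □₃₄) σ₁₂₃₄ = □₁₂ , □₃₄
  sixSquares⇒outerSquares x y (□₁₂ , □₁₃ , □₁₄ , □₂₃ , □₂₄ , □₃₄) σ₁₄₂₃ = □₁₄ , □₂₃
  sixSquares⇒outerSquares x y (□₁₂ , □₁₃ , □₁₄ , □₂₃ , □₂₄ , □₃₄) σ₁₃₂₄ = □₁₃ , □₂₄

  outerSquares⇒sixSquares : ∀ x y → (∀ τ → OuterSquares (form τ x y)) → SixSquares x y
  outerSquares⇒sixSquares x y □ =
    proj₁ (□ σ₁₂₃₄) , proj₁ (□ σ₁₃₂₄) , proj₁ (□ σ₁₄₂₃) ,
    proj₂ (□ σ₁₄₂₃) , proj₂ (□ σ₁₃₂₄) , proj₂ (□ σ₁₂₃₄)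

  P≡0-rotate : ∀ σ c s → c * c + s * s ≡ 1ℚ → ∀ x y → P x y ≡ 0ℚ →
    P (x′ σ c s x y) (y′ σ c s x y) ≡ 0ℚ
  P≡0-rotate σ c s c²+s²≡1 x y P≡0 = begin
    P (x′ σ c s x y) (y′ σ c s x y)             ≡⟨ P-rotate σ c s x y ⟩
    (c * c + s * s) * (c * c + s * s) * P x y   ≡⟨ ≡.cong₂ (λ k p → k * k * p) c²+s²≡1 P≡0 ⟩
    1ℚ * 1ℚ * 0ℚ                                ≡⟨ ℚ.*-zeroʳ (1ℚ * 1ℚ) ⟩
    0ℚ                                          ∎

  regular-solution-rotate : ∀ σ c s → c * c + s * s ≡ 1ℚ → ∀ x y → P x y ≡ 0ℚ → SixSquares x y →
    P (x′ σ c s x y) (y′ σ c s x y) ≡ 0ℚ × SixSquares (x′ σ c s x y) (y′ σ c s x y)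
  regular-solution-rotate σ c s c²+s²≡1 x y P≡0 six =
      P≡0-rotate σ c s c²+s²≡1 x y P≡0
    , outerSquares⇒sixSquares (x′ σ c s x y) (y′ σ c s x y) λ τ →
        transformed-outerSquares σ τ c s c²+s²≡1 x y P≡0 (sixSquares⇒outerSquares x y six τ)

mainTheorem2 : ∀ {a ℓ : Level} →
  ((R : CommutativeRing a ℓ) → (σ : Involution) →
    (c s : CommutativeRing.Carrier R) → (x y : Fin 4 → CommutativeRing.Carrier R) →
    CommutativeRing._≈_ R
      (OverRing.P R (OverRing.x′ R σ c s x y) (OverRing.y′ R σ c s x y))
      (CommutativeRing._*_ R
        (CommutativeRing._*_ R
          (CommutativeRing._+_ R (CommutativeRing._*_ R c c) (CommutativeRing._*_ R s s))
          (CommutativeRing._+_ R (CommutativeRing._*_ R c c) (CommutativeRing._*_ R s s)))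
        (OverRing.P R x y)))
  ×
  ((σ : Involution) → (c s : ℚ) → c * c + s * s ≡ 1ℚ →
    (x y : Fin 4 → ℚ) → Qdefs.P x y ≡ 0ℚ → SixSquares x y →
    (Qdefs.P (Qdefs.x′ σ c s x y) (Qdefs.y′ σ c s x y) ≡ 0ℚ)
    × SixSquares (Qdefs.x′ σ c s x y) (Qdefs.y′ σ c s x y))
mainTheorem2 = Invariance.P-rotate , Rational.regular-solution-rotate
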